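{- Let $P$ be a process template with reachability-unwinding $P^{\multimap}$, and let $\mathcal P^{\multimap}$ be the infinite RB-system with template $P^{\multimap}$. For all $b,N\in\mathbb N$ there is a finite run $\pi$ of $\mathcal P^{\multimap}$ containing exactly $b$ broadcast transitions such that, writing $f$ for the last configuration of $\pi$, we have $|f^{ -1}((s,\mathrm{comp}(b)))|\ge N$ for every $s\in S_{\mathrm{comp}(b)}$.
   Context: Fix an integer $k\ge 1$ and a finite set $\Sigma_{\mathrm{actn}}$ of rendezvous actions; let $\Sigma_{\mathrm{rdz}}=\bigcup_{a\in\Sigma_{\mathrm{actn}}}\{a_1,\dots,a_k\}$ and let $\mathfrak b$ be a fresh broadcast symbol. A process template is a finite labeled transition system $P=(S,I,R,\Sigma_{\mathrm{rdz}}\cup\{\mathfrak b\})$ with finite state set $S$, initial states $I\subseteq S$ and edges $R\subseteq S\times(\Sigma_{\mathrm{rdz}}\cup\{\mathfrak b\})\times S$, such that every $s\in S$ has an outgoing edge $(s,\mathfrak b,s')\in R$; for the given template $P$ it is moreover assumed that every $\varsigma\in\Sigma_{\mathrm{rdz}}$ labels at most one edge of $R$. For a template and $n\in\mathbb N$, the RB-system $\mathcal P^n$ is the transition system whose configurations are maps $f:[n]\to S$, whose initial configurations are those with $f(i)\in I$ for all $i$, and whose transitions are: broadcast transitions $(f,\mathfrak b,g)$ with $(f(i),\mathfrak b,g(i))\in R$ for all $i\in[n]$; and rendezvous transitions $(f,((i_1,a_1),\dots,(i_k,a_k)),g)$ where $a\in\Sigma_{\mathrm{actn}}$, $i_1,\dots,i_k\in[n]$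 are pairwise distinct, $(f(i_j),a_j,g(i_j))\in R$ for all $j\in[k]$, and $g(i)=f(i)$ for $i\notin\{i_1,\dots,i_k\}$. The infinite RB-system $\mathcal P$ is the union of all $\mathcal P^n$, $n\in\mathbb N$. A run is a finite or infinite path starting at an initial configuration. Reachability-unwinding: define for $i\ge 0$ sets $I_i,S_i\subseteq S$ and $R_i\subseteq R$ by $I_0=I$, $I_i=\{s\in S\mid (h,\mathfrak b,s)\in R\text{ for some }h\in S_{i-1}\}$ for $i>0$, and $(S_i,R_i)$ obtained by saturation: start with $S_i=I_i$, $R_i=\emptyset$, and repeatedly add an edge $e=(s,a_h,t)\in R\setminus R_i$ (with $a_h\in\Sigma_{\mathrm{rdz}}$) to $R_i$ and $t$ to $S_i$ whenever for every $l\in[k]$ there is an edge $(s',a_l,t')\in R$ with $s'\in S_i$, until a fixed point. Let $m$ be least such that $(S_{m+1},I_{m+1},R_{m+1})=(S_n,I_n,R_n)$ for some $n\le m$ ($n$ is the prefix length, $r=m+1-n$ the period). For $i\in\mathbb N_0$ let $\mathrm{comp}(i)=i$ if $i<n$ and $\mathrm{comp}(i)=n+((i-n)\bmod r)$ if $i\ge n$. $P^{\multimap}$ is the template with states $\bigcup_{i=0}^m S_i\times\{i\}$, initial states $I\times\{0\}$, rendezvous edges $((s,i),\varsigma,(t,i))$ for $(s,\varsigma,t)\in R_i$, and broadcast edges $((s,i),\mathfrak b,(t,i+1))$ for $i<m$, $s\in S_i$, $(s,\mathfrak b,t)\in R$, and $((s,m),\mathfrak b,(t,n))$ for $s\in S_m$,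 $(s,\mathfrak b,t)\in R$ (in $P^{\multimap}$ a rendezvous label may label several edges). The states $S_j\times\{j\}$ form the component $P_j$ of $P^{\multimap}$. -}

module Defs where

open import Data.Nat using (ℕ; zero; suc; _+_; _∸_; _≤_; _<_; _<?_)
open import Data.Nat.DivMod using (_%_)
open import Data.Fin using (Fin)
open import Data.Bool using (Bool; true; false; T; if_then_else_)
open import Data.Product using (Σ; ∃; ∃-syntax; _×_; _,_)
open import Data.Product.Properties using (≡-dec)
open import Data.Nat.Properties using () renaming (_≟_ to _≟ℕ_)
open import Data.Fin.Properties using () renaming (_≟_ to _≟F_)
open import Relation.Nullary using (¬_; Dec; yes; no)
open import Relation.Binary.PropositionalEquality using (_≡_; _≢_)
open import Function.Bundles using (_⇔_)
open import Function.Definitions using (Injective)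

-- Labels: the broadcast symbol 𝔟, and rendezvous symbols a_j
-- (a ∈ Σ_actn, j ∈ [k]; Fin k indexes the subscripts 1..k).

data Label (Act : Set) (k : ℕ) : Set where
  bc  : Label Act k
  rdz : Act → Fin k → Label Act k

record Template (Act : Set) (k : ℕ) : Set₁ where
  field
    State : Set
    Init  : State → Set
    Edge  : State → Label Act k → State → Set

module RB {Act : Set} {k : ℕ} (P : Template Act k) where
  open Template P

  Config : ℕ → Set
  Config N = Fin N → State

  Initial : ∀ {N} → Config N → Set
  Initial f = ∀ i → Init (f i)

  BStep : ∀ {N} → Config N → Config N → Set
  BStep f g = ∀ i → Edge (f i) bc (g i)

  record RStep {N : ℕ} (f g : Config N) : Set where
    field
      act   : Act
      ids   : Fin k → Fin N
      ids-distinct : Injective _≡_ _≡_ ids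
      moves : ∀ j → Edge (f (ids j)) (rdz act j) (g (ids j))
      rest  : ∀ i → (∀ j → ids j ≢ i) → g i ≡ f i

  data Path {N : ℕ} (f : Config N) : Config N → ℕ → Set where
    here  : Path f f 0
    bstep : ∀ {g h b} → Path f g b → BStep g h → Path f h (suc b)
    rstep : ∀ {g h b} → Path f g b → RStep g h → Path f h b

  Run : ∀ {N} → Config N → ℕ → Set
  Run {N} g b = Σ (Config N) λ f → Initial f × Path f g b

count : ∀ {N} → (Fin N → Bool) → ℕ
count {zero}  p = 0
count {suc N} p = (if p Fin.zero then 1 else 0) + count (λ i → p (Fin.suc i))

isYes : ∀ {A : Set} → Dec A → Bool
isYes (yes _) = true
isYes (no _)  = false

-- The given process template P with states S = Fin nS, actions
-- Σ_actn = Fin nA, initial states and edges given as finite (Boolean)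
-- subsets.

module Unwinding {nS nA k : ℕ}
  (Init : Fin nS → Bool)
  (E : Fin nS → Label (Fin nA) k → Fin nS → Bool) where

  R : Fin nS → Label (Fin nA) k → Fin nS → Set
  R s ς t = T (E s ς t)

  BcTotal : Set
  BcTotal = ∀ s → ∃[ t ] R s bc t

  RdzUnique : Set
  RdzUnique = ∀ (a : Fin nA) (j : Fin k) s t s' t' →
    R s (rdz a j) t → R s' (rdz a j) t' → (s ≡ s') × (t ≡ t')

  -- Reachability-unwinding: I_i, S_i, R_i (S_i, R_i as least fixed
  -- point of the saturation, i.e. inductively generated).
  data Iu : ℕ → Fin nS → Set
  data Su : ℕ → Fin nS → Set
  data Ru : ℕ → Fin nS → Label (Fin nA) k → Fin nS → Set

  data Iu where
    init : ∀ {s} → T (Init s) → Iu 0 s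
    succ : ∀ {i h s} → Su i h → R h bc s → Iu (suc i) s

  data Su where
    base : ∀ {i s} → Iu i s → Su i s
    tgt  : ∀ {i s ς t} → Ru i s ς t → Su i t

  data Ru where
    sat : ∀ {i s a h t} → R s (rdz a h) t →
          (∀ (l : Fin k) → ∃[ s' ] ∃[ t' ] (Su i s' × R s' (rdz a l) t')) →
          Ru i s (rdz a h) t

  SameLevel : ℕ → ℕ → Set
  SameLevel i j =
    (∀ s → Su i s ⇔ Su j s) × (∀ s → Iu i s ⇔ Iu j s) ×
    (∀ s ς t → Ru i s ς t ⇔ Ru j s ς t)

  IsUnwindingBounds : ℕ → ℕ → Set
  IsUnwindingBounds n m =
    n ≤ m × SameLevel (suc m) n ×
    (∀ m' n' → m' < m → n' ≤ m' → ¬ SameLevel (suc m') n')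

  module Unwound (n m : ℕ) where

    -- period r = m + 1 - n (written suc (m ∸ n), equal since n ≤ m)
    r : ℕ
    r = suc (m ∸ n)

    comp : ℕ → ℕ
    comp i with i <? n
    ... | yes _ = i
    ... | no  _ = n + ((i ∸ n) % r)

    -- P^⊸. States are pairs (s , i); only pairs with i ≤ m and s ∈ S_i
    -- carry edges / are initial, so all reachable states lie in
    -- ⋃_{i ≤ m} S_i × {i}.
    data Edge⊸ : Fin nS × ℕ → Label (Fin nA) k → Fin nS × ℕ → Set where
      rdzE  : ∀ {s i a j t} → i ≤ m → Ru i s (rdz a j) t →
              Edge⊸ (s , i) (rdz a j) (t , i)
      bcE   : ∀ {s i t} → i < m → Su i s → R s bc t →
              Edge⊸ (s , i) bc (t , suc i)
      bcEnd : ∀ {s t} → Su m s → R s bc t →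
              Edge⊸ (s , m) bc (t , n)

    P⊸ : Template (Fin nA) k
    P⊸ = record
      { State = Fin nS × ℕ
      ; Init  = λ { (s , i) → T (Init s) × i ≡ 0 }
      ; Edge  = Edge⊸ }

    open RB P⊸ public

    preimageSize : ∀ {N} → Config N → Fin nS × ℕ → ℕ
    preimageSize f x = count (λ i → isYes (≡-dec _≟F_ _≟ℕ_ (f i) x))

-- Call a run of 𝒫^⊸ confined after b broadcasts if every process is then in
-- component P_comp(b). Every s ∈ S_comp(b) is covered by such a run, i.e. one
-- with a process in (s , comp b), by induction on b and on the saturation
-- generating S_comp(b): initial states are covered by a single process; a
-- broadcast moves a covering of a predecessor of s into the next component,
-- since every state has a broadcast edge and comp(b + 1) is the component that
-- P_comp(b) broadcasts into; and a rendezvous edge a_h into s fires from k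
-- coverings of the sources of a, placed side by side. Runs with the same number
-- of broadcasts compose in parallel, so N copies of a covering of each
-- s ∈ S_comp(b) (a decidable set, being a least fixed point over a finite set)
-- form the required run.
module Submission where

open import Defs
open import Data.Bool using (Bool; true; T; if_then_else_)
open import Data.Bool.Properties using (T?)
open import Data.Empty using (⊥-elim)
open import Data.Fin using (Fin; zero; suc; _↑ˡ_; _↑ʳ_; splitAt)
open import Data.Fin.Properties
  using (any?; all?; ↑ˡ-injective; ↑ʳ-injective; splitAt-↑ˡ; splitAt-↑ʳ; splitAt⁻¹-↑ˡ; splitAt⁻¹-↑ʳ)
  renaming (_≟_ to _≟ᶠ_)
open import Data.Fin.Subset using (Subset; _∈_; _∪_; ⁅_⁆; _⊃_) renaming (⊥ to ∅ˢ)
open import Data.Fin.Subset.Properties using (_∈?_; ∉⊥; p⊆p∪q; x∈p∪q⁺; x∈p∪q⁻; x∈⁅x⁆; x∈⁅y⁆⇒x≡y)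
open import Data.Fin.Subset.Induction using (⊃-wellFounded)
open import Data.Nat using (ℕ; zero; suc; _+_; _*_; _∸_; _≤_; _<_; _<?_; z≤n; s≤s; NonZero)
open import Data.Nat.DivMod using (_%_; _/_; m≡m%n+[m/n]*n; [m+kn]%n≡m%n; m%n<n; m<n⇒m%n≡m; n%n≡0)
open import Data.Nat.Properties
open import Data.Product using (Σ; ∃; ∃-syntax; _×_; _,_; proj₁; proj₂)
open import Data.Product.Properties using (≡-dec)
open import Data.Sum using (_⊎_; inj₁; inj₂)
open import Data.Vec.Functional using (Vector; _++_; [])
open import Data.Vec.Functional.Properties using (lookup-++ˡ; lookup-++ʳ)
import Data.Vec.Functional.Relation.Binary.Pointwise.Properties as Pointwise
import Data.Vec.Functional.Relation.Unary.All.Properties as All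
open import Function using (_∘_)
open import Function.Bundles using (_⇔_; mk⇔; Equivalence)
open import Induction.WellFounded using (Acc; acc)
open import Relation.Nullary using (Dec; yes; no; ¬?; map′)
open import Relation.Nullary.Decidable using (_×-dec_; _⊎-dec_; decidable-stable)
open import Relation.Unary using (Decidable)
open import Relation.Binary.PropositionalEquality

↑ˡ≢↑ʳ : ∀ {M₁ M₂} (i : Fin M₁) (j : Fin M₂) → i ↑ˡ M₂ ≢ M₁ ↑ʳ j
↑ˡ≢↑ʳ {M₁} {M₂} i j e
  with trans (sym (splitAt-↑ˡ M₁ i M₂)) (trans (cong (splitAt M₁) e) (splitAt-↑ʳ M₁ M₂ j))
... | ()

module Parallel {Act : Set} {k : ℕ} (P : Template Act k) where
  open Template P
  open RB P

  RStep-++ˡ : ∀ {M₁ M₂} {f g : Config M₁} (c : Config M₂) → RStep f g → RStep (f ++ c) (g ++ c)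
  RStep-++ˡ {M₁} {M₂} {f} {g} c step = record
    { act = act
    ; ids = λ j → ids j ↑ˡ M₂
    ; ids-distinct = ids-distinct ∘ ↑ˡ-injective M₂ _ _
    ; moves = λ j → subst₂ (λ x y → Edge x (rdz act j) y)
        (sym (lookup-++ˡ f c (ids j))) (sym (lookup-++ˡ g c (ids j))) (moves j)
    ; rest = rest′
    }
    where
      open RStep step
      rest′ : ∀ i → (∀ j → ids j ↑ˡ M₂ ≢ i) → (g ++ c) i ≡ (f ++ c) i
      rest′ i untouched with splitAt M₁ i in eq
      ... | inj₁ x = rest x (λ j e → untouched j (trans (cong (_↑ˡ M₂) e) (splitAt⁻¹-↑ˡ eq)))
      ... | inj₂ y = refl

  RStep-++ʳ : ∀ {M₁ M₂} {f g : Config M₂} (c : Config M₁) → RStep f g → RStep (c ++ f) (c ++ g)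
  RStep-++ʳ {M₁} {M₂} {f} {g} c step = record
    { act = act
    ; ids = λ j → M₁ ↑ʳ ids j
    ; ids-distinct = ids-distinct ∘ ↑ʳ-injective M₁ _ _
    ; moves = λ j → subst₂ (λ x y → Edge x (rdz act j) y)
        (sym (lookup-++ʳ c f (ids j))) (sym (lookup-++ʳ c g (ids j))) (moves j)
    ; rest = rest′
    }
    where
      open RStep step
      rest′ : ∀ i → (∀ j → M₁ ↑ʳ ids j ≢ i) → (c ++ g) i ≡ (c ++ f) i
      rest′ i untouched with splitAt M₁ i in eq
      ... | inj₁ x = refl
      ... | inj₂ y = rest y (λ j e → untouched j (trans (cong (M₁ ↑ʳ_) e) (splitAt⁻¹-↑ʳ eq)))

  Path-++ : ∀ {M₁ M₂} {f₁ g₁ : Config M₁} {f₂ g₂ : Config M₂} {b} →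
    Path f₁ g₁ b → Path f₂ g₂ b → Path (f₁ ++ f₂) (g₁ ++ g₂) b
  Path-++ {g₁ = g₁} p₁ (rstep p₂ r) = rstep (Path-++ p₁ p₂) (RStep-++ʳ g₁ r)
  Path-++ {g₂ = g₂} (rstep p₁ r) p₂ = rstep (Path-++ p₁ p₂) (RStep-++ˡ g₂ r)
  Path-++ here here = here
  Path-++ (bstep p₁ s₁) (bstep p₂ s₂) = bstep (Path-++ p₁ p₂) (Pointwise.++⁺ (λ x y → Edge x bc y) s₁ s₂)

  Run-++ : ∀ {M₁ M₂} {g₁ : Config M₁} {g₂ : Config M₂} {b} → Run g₁ b → Run g₂ b → Run (g₁ ++ g₂) b
  Run-++ (f₁ , init₁ , p₁) (f₂ , init₂ , p₂) = f₁ ++ f₂ , All.++⁺ Init init₁ init₂ , Path-++ p₁ p₂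

  Run-[] : ∀ b → Run [] b
  Run-[] b = [] , (λ ()) , broadcasts b
    where
      broadcasts : ∀ b → Path [] [] b
      broadcasts zero = here
      broadcasts (suc b) = bstep (broadcasts b) (λ ())

count-cong : ∀ {N} {p q : Fin N → Bool} → (∀ i → p i ≡ q i) → count p ≡ count q
count-cong {zero} _ = refl
count-cong {suc N} p≗q = cong₂ (λ x c → (if x then 1 else 0) + c) (p≗q zero) (count-cong (p≗q ∘ suc))

count-+ : ∀ M₁ {M₂} (p : Fin (M₁ + M₂) → Bool) →
  count p ≡ count (p ∘ (_↑ˡ M₂)) + count (p ∘ (M₁ ↑ʳ_))
count-+ zero p = refl
count-+ (suc M₁) p = trans (cong ((if p zero then 1 else 0) +_) (count-+ M₁ (p ∘ suc)))
  (sym (+-assoc (if p zero then 1 else 0) _ _))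

count-++ : ∀ {A : Set} {M₁ M₂} (q : A → Bool) (f : Vector A M₁) (g : Vector A M₂) →
  count (q ∘ (f ++ g)) ≡ count (q ∘ f) + count (q ∘ g)
count-++ {M₁ = M₁} q f g = trans (count-+ M₁ (q ∘ (f ++ g)))
  (cong₂ _+_ (count-cong (cong q ∘ lookup-++ˡ f g)) (count-cong (cong q ∘ lookup-++ʳ f g)))

count-pos : ∀ {N} (p : Fin N → Bool) i → p i ≡ true → 1 ≤ count p
count-pos p zero pi≡true rewrite pi≡true = s≤s z≤n
count-pos p (suc i) pi≡true = ≤-trans (count-pos (p ∘ suc) i pi≡true) (m≤n+m _ _)

isYes-true : ∀ {A : Set} (d : Dec A) → A → isYes d ≡ true
isYes-true (yes _) _ = refl
isYes-true (no ¬a) a = ⊥-elim (¬a a)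

module _ {n : ℕ} (Ind : Fin n → Set) (Cond : Subset n → Fin n → Set)
  (cond? : ∀ X t → Dec (Cond X t))
  (sound : ∀ {X t} → (∀ {x} → x ∈ X → Ind x) → Cond X t → Ind t)
  (least : ∀ X → (∀ {t} → Cond X t → t ∈ X) → ∀ {t} → Ind t → t ∈ X) where

  saturation-decidable : Decidable Ind
  saturation-decidable t = map′ Y⊆Ind (least Y Y-closed) (t ∈? Y)
    where
      saturate : ∀ X → Acc _⊃_ X → (∀ {x} → x ∈ X → Ind x) →
        ∃[ Y ] ((∀ {x} → x ∈ Y → Ind x) × (∀ {t} → Cond Y t → t ∈ Y))
      saturate X (acc larger) X⊆Ind with any? (λ t → cond? X t ×-dec ¬? (t ∈? X))
      ... | no none = X , X⊆Ind , λ {t} c → decidable-stable (t ∈? X) (λ t∉X → none (t , c , t∉X))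
      ... | yes (t , c , t∉X) =
        saturate (X ∪ ⁅ t ⁆) (larger (p⊆p∪q ⁅ t ⁆ , t , x∈p∪q⁺ (inj₂ (x∈⁅x⁆ t)) , t∉X)) X∪t⊆Ind
        where
          X∪t⊆Ind : ∀ {x} → x ∈ X ∪ ⁅ t ⁆ → Ind x
          X∪t⊆Ind x∈X∪t with x∈p∪q⁻ X ⁅ t ⁆ x∈X∪t
          ... | inj₁ x∈X = X⊆Ind x∈X
          ... | inj₂ x∈t = subst Ind (sym (x∈⁅y⁆⇒x≡y t x∈t)) (sound X⊆Ind c)
      saturated = saturate ∅ˢ (⊃-wellFounded ∅ˢ) (⊥-elim ∘ ∉⊥)
      Y = proj₁ saturated
      Y⊆Ind = proj₁ (proj₂ saturated)
      Y-closed = proj₂ (proj₂ saturated)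

[1+m]%n≡[1+m%n]%n : ∀ m n .{{_ : NonZero n}} → suc m % n ≡ suc (m % n) % n
[1+m]%n≡[1+m%n]%n m n = begin
  suc m % n                     ≡⟨ cong (λ x → suc x % n) (m≡m%n+[m/n]*n m n) ⟩
  (suc (m % n) + m / n * n) % n ≡⟨ [m+kn]%n≡m%n (suc (m % n)) (m / n) n ⟩
  suc (m % n) % n               ∎
  where open ≡-Reasoning

suc-% : ∀ m d → (m % suc d < d × suc m % suc d ≡ suc (m % suc d)) ⊎
                (m % suc d ≡ d × suc m % suc d ≡ 0)
suc-% m d with m≤n⇒m<n∨m≡n (≤-pred (m%n<n m (suc d)))
... | inj₁ lt = inj₁ (lt , trans ([1+m]%n≡[1+m%n]%n m (suc d)) (m<n⇒m%n≡m (s≤s lt)))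
... | inj₂ eq = inj₂ (eq , trans ([1+m]%n≡[1+m%n]%n m (suc d))
                                 (trans (cong (λ x → suc x % suc d) eq) (n%n≡0 (suc d))))

module UnwindingDecidable {nS nA k : ℕ}
  (Init : Fin nS → Bool) (E : Fin nS → Label (Fin nA) k → Fin nS → Bool) where
  open Unwinding Init E

  Enabled : (Fin nS → Set) → Fin nA → Set
  Enabled P a = ∀ l → ∃[ s ] ∃[ t ] (P s × R s (rdz a l) t)

  enabled? : ∀ {P} → Decidable P → ∀ a → Dec (Enabled P a)
  enabled? P? a = all? λ l → any? λ s → any? λ t → P? s ×-dec T? (E s (rdz a l) t)

  Iu-suc⁻ : ∀ {i t} → Iu (suc i) t → ∃[ h ] (Su i h × R h bc t)
  Iu-suc⁻ (succ su e) = _ , su , e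

  SuStep : ℕ → Subset nS → Fin nS → Set
  SuStep i X t = Iu i t ⊎ ∃[ s ] ∃[ a ] ∃[ h ] (R s (rdz a h) t × Enabled (_∈ X) a)

  Su-least : ∀ {i X} → (∀ {t} → SuStep i X t → t ∈ X) → ∀ {t} → Su i t → t ∈ X
  Su-least closed (base iu) = closed (inj₁ iu)
  Su-least closed (tgt (sat e w)) =
    closed (inj₂ (_ , _ , _ , e , λ l → let s , t , su , e′ = w l in s , t , Su-least closed su , e′))

  Iu? : ∀ i → Decidable (Iu i)
  Su? : ∀ i → Decidable (Su i)

  Iu? zero s = map′ init (λ { (init x) → x }) (T? (Init s))
  Iu? (suc i) s = map′ (λ (h , su , e) → succ su e) Iu-suc⁻ (any? λ h → Su? i h ×-dec T? (E h bc s))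

  Su? i = saturation-decidable (Su i) (SuStep i) step? sound (λ _ → Su-least)
    where
      step? : ∀ X t → Dec (SuStep i X t)
      step? X t = Iu? i t ⊎-dec (any? λ s → any? λ a → any? λ h →
                    T? (E s (rdz a h) t) ×-dec enabled? (_∈? X) a)
      sound : ∀ {X t} → (∀ {x} → x ∈ X → Su i x) → SuStep i X t → Su i t
      sound X⊆Su (inj₁ iu) = base iu
      sound X⊆Su (inj₂ (s , a , h , e , w)) =
        tgt (sat e (λ l → let s , t , s∈X , e′ = w l in s , t , X⊆Su s∈X , e′))

module Levels {nS nA k : ℕ}
  (Init : Fin nS → Bool) (E : Fin nS → Label (Fin nA) k → Fin nS → Bool)
  (n m : ℕ) (n≤m : n ≤ m) (loop : Unwinding.SameLevel Init E (suc m) n) where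
  open Unwinding Init E
  open Unwound n m
  open UnwindingDecidable Init E using (Iu-suc⁻)

  -- Next L L′: the broadcast edges of P⊸ leaving component P_L enter P_L′.
  data Next : ℕ → ℕ → Set where
    step : ∀ {L} → L < m → Next L (suc L)
    wrap : Next m n

  Next-≤ : ∀ {L L′} → Next L L′ → L ≤ m
  Next-≤ (step L<m) = <⇒≤ L<m
  Next-≤ wrap = ≤-refl

  Next-edge : ∀ {L L′ s t} → Next L L′ → Su L s → R s bc t → Edge⊸ (s , L) bc (t , L′)
  Next-edge (step L<m) = bcE L<m
  Next-edge wrap = bcEnd

  Next-Iu : ∀ {L L′ t} → Next L L′ → Iu L′ t ⇔ (∃[ h ] (Su L h × R h bc t))
  Next-Iu (step _) = mk⇔ Iu-suc⁻ (λ (_ , su , e) → succ su e)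
  Next-Iu {t = t} wrap = mk⇔ (Iu-suc⁻ ∘ Equivalence.from Iu[m+1]⇔Iu[n])
                              (λ (_ , su , e) → Equivalence.to Iu[m+1]⇔Iu[n] (succ su e))
    where Iu[m+1]⇔Iu[n] = proj₁ (proj₂ loop) t

  comp-≤ : ∀ {b} → b ≤ n → comp b ≡ b
  comp-≤ {b} b≤n with b <? n
  ... | yes _ = refl
  ... | no b≮n with ≤-antisym b≤n (≮⇒≥ b≮n)
  ... | refl = trans (cong (λ x → b + x % r) (n∸n≡0 b)) (+-identityʳ b)

  comp-zero : comp 0 ≡ 0
  comp-zero = comp-≤ z≤n

  comp-+ : ∀ x → comp (n + x) ≡ n + x % r
  comp-+ x with n + x <? n
  ... | yes n+x<n = ⊥-elim (<⇒≱ n+x<n (m≤m+n n x))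
  ... | no _ = cong (λ y → n + y % r) (m+n∸m≡n n x)

  Next-% : ∀ x → Next (n + x % r) (n + suc x % r)
  Next-% x with suc-% x (m ∸ n)
  ... | inj₁ (x%r<m∸n , eq) =
    subst (Next _) (sym (trans (cong (n +_) eq) (+-suc n (x % r))))
      (step (subst (n + x % r <_) (m+[n∸m]≡n n≤m) (+-monoʳ-< n x%r<m∸n)))
  ... | inj₂ (x%r≡m∸n , eq) =
    subst₂ Next (trans (sym (m+[n∸m]≡n n≤m)) (cong (n +_) (sym x%r≡m∸n)))
                (trans (sym (+-identityʳ n)) (cong (n +_) (sym eq))) wrap

  comp-next : ∀ b → Next (comp b) (comp (suc b))
  comp-next b with ≤-<-connex (suc b) n
  ... | inj₁ b<n = subst₂ Next (sym (comp-≤ (<⇒≤ b<n))) (sym (comp-≤ b<n)) (step (<-≤-trans b<n n≤m))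
  ... | inj₂ n<1+b = subst (λ b → Next (comp b) (comp (suc b))) (m+[n∸m]≡n n≤b) (comp-next-+ (b ∸ n))
    where
      n≤b = ≤-pred n<1+b
      comp-next-+ : ∀ x → Next (comp (n + x)) (comp (suc (n + x)))
      comp-next-+ x = subst₂ Next (sym (comp-+ x))
        (sym (trans (cong comp (sym (+-suc n x))) (comp-+ (suc x)))) (Next-% x)

module Coverings {nS nA k : ℕ}
  (Init : Fin nS → Bool) (E : Fin nS → Label (Fin nA) k → Fin nS → Bool)
  (bc-total : Unwinding.BcTotal Init E) (rdz-unique : Unwinding.RdzUnique Init E)
  (n m : ℕ) (n≤m : n ≤ m) (loop : Unwinding.SameLevel Init E (suc m) n) where
  open Unwinding Init E
  open Unwound n m
  open UnwindingDecidable Init E using (Enabled; Su?)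
  open Levels Init E n m n≤m loop
  open Parallel P⊸

  data InComponent (L : ℕ) : Fin nS × ℕ → Set where
    component : ∀ {s} → Su L s → InComponent L (s , L)

  record ComponentRun (b : ℕ) : Set where
    field
      size     : ℕ
      conf     : Config size
      run      : Run conf b
      confined : ∀ i → InComponent (comp b) (conf i)
  open ComponentRun

  _⊕_ : ∀ {b} → ComponentRun b → ComponentRun b → ComponentRun b
  ρ ⊕ σ = record
    { size = size ρ + size σ
    ; conf = conf ρ ++ conf σ
    ; run = Run-++ (run ρ) (run σ)
    ; confined = All.++⁺ (InComponent _) (confined ρ) (confined σ)
    }

  ∅ : ∀ {b} → ComponentRun b
  ∅ {b} = record { size = 0 ; conf = [] ; run = Run-[] b ; confined = λ () }

  ⨁ : ∀ {b j} → (Fin j → ComponentRun b) → ComponentRun b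
  ⨁ {j = zero} G = ∅
  ⨁ {j = suc j} G = G zero ⊕ ⨁ (G ∘ suc)

  ⨁-index : ∀ {b j} (G : Fin j → ComponentRun b) l → Fin (size (G l)) → Fin (size (⨁ G))
  ⨁-index G zero i = i ↑ˡ _
  ⨁-index G (suc l) i = size (G zero) ↑ʳ ⨁-index (G ∘ suc) l i

  ⨁-conf : ∀ {b j} (G : Fin j → ComponentRun b) l i → conf (⨁ G) (⨁-index G l i) ≡ conf (G l) i
  ⨁-conf G zero i = lookup-++ˡ (conf (G zero)) _ i
  ⨁-conf G (suc l) i = trans (lookup-++ʳ (conf (G zero)) _ _) (⨁-conf (G ∘ suc) l i)

  ⨁-index-injective : ∀ {b j} (G : Fin j → ComponentRun b) {l l′ i i′} →
    ⨁-index G l i ≡ ⨁-index G l′ i′ → l ≡ l′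
  ⨁-index-injective G {zero} {zero} e = refl
  ⨁-index-injective G {zero} {suc l′} e = ⊥-elim (↑ˡ≢↑ʳ _ _ e)
  ⨁-index-injective G {suc l} {zero} e = ⊥-elim (↑ˡ≢↑ʳ _ _ (sym e))
  ⨁-index-injective G {suc l} {suc l′} e =
    cong suc (⨁-index-injective (G ∘ suc) (↑ʳ-injective (size (G zero)) _ _ e))

  preimageSize-++ : ∀ {M₁ M₂} (f : Config M₁) (g : Config M₂) x →
    preimageSize (f ++ g) x ≡ preimageSize f x + preimageSize g x
  preimageSize-++ f g x = count-++ (λ y → isYes (≡-dec _≟ᶠ_ _≟_ y x)) f g

  preimageSize-⨁-≥ : ∀ {b j} (G : Fin j → ComponentRun b) l x →
    preimageSize (conf (G l)) x ≤ preimageSize (conf (⨁ G)) x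
  preimageSize-⨁-≥ G zero x =
    subst (_ ≤_) (sym (preimageSize-++ (conf (G zero)) _ x)) (m≤m+n _ _)
  preimageSize-⨁-≥ G (suc l) x =
    subst (_ ≤_) (sym (preimageSize-++ (conf (G zero)) _ x))
      (≤-trans (preimageSize-⨁-≥ (G ∘ suc) l x) (m≤n+m _ _))

  preimageSize-⨁-≥-arity : ∀ {b j} (G : Fin j → ComponentRun b) x →
    (∀ l → 1 ≤ preimageSize (conf (G l)) x) → j ≤ preimageSize (conf (⨁ G)) x
  preimageSize-⨁-≥-arity {j = zero} G x _ = z≤n
  preimageSize-⨁-≥-arity {j = suc j} G x occupied =
    subst (suc j ≤_) (sym (preimageSize-++ (conf (G zero)) _ x))
      (+-mono-≤ (occupied zero) (preimageSize-⨁-≥-arity (G ∘ suc) x (occupied ∘ suc)))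

  Covering : ℕ → Fin nS → Set
  Covering b s = Σ (ComponentRun b) λ ρ → ∃ λ i → conf ρ i ≡ (s , comp b)

  Covering-occupied : ∀ {b s} ((ρ , i , _) : Covering b s) → 1 ≤ preimageSize (conf ρ) (s , comp b)
  Covering-occupied (ρ , i , at-i) = count-pos _ i (isYes-true (≡-dec _≟ᶠ_ _≟_ _ _) at-i)

  Covering-init : ∀ {s} → T (Init s) → Covering 0 s
  Covering-init {s} init-s = record
    { size = 1
    ; conf = λ _ → s , 0
    ; run = (λ _ → s , 0) , (λ _ → init-s , refl) , here
    ; confined = λ _ → subst (λ L → InComponent L (s , 0)) (sym comp-zero) (component (base (init init-s)))
    } , zero , cong (s ,_) (sym comp-zero)

  Covering-bc : ∀ {b h s} → Covering b h → R h bc s → Covering (suc b) s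
  Covering-bc {b} {h} {s} (ρ , p , at-p) e = record
    { size = size ρ
    ; conf = conf′
    ; run = let f , init-f , path = run ρ in
            f , init-f , bstep path (λ i → proj₁ (step-from (confined ρ i) (proj₁ (proj₂ (move i)))))
    ; confined = λ i → proj₂ (step-from (confined ρ i) (proj₁ (proj₂ (move i))))
    } , p , cong (_, comp (suc b)) (proj₂ (proj₂ (move p)) refl)
    where
      move : ∀ i → ∃[ t ] (R (proj₁ (conf ρ i)) bc t × (i ≡ p → t ≡ s))
      move i with i ≟ᶠ p
      ... | yes refl = s , subst (λ x → R (proj₁ x) bc s) (sym at-p) e , λ _ → refl
      ... | no i≢p = let t , e′ = bc-total _ in t , e′ , ⊥-elim ∘ i≢p
      conf′ : Config (size ρ)
      conf′ i = proj₁ (move i) , comp (suc b)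
      step-from : ∀ {x t} → InComponent (comp b) x → R (proj₁ x) bc t →
        Edge⊸ x bc (t , comp (suc b)) × InComponent (comp (suc b)) (t , comp (suc b))
      step-from (component su) e =
        Next-edge (comp-next b) su e , component (base (Equivalence.from (Next-Iu (comp-next b)) (_ , su , e)))

  Covering-rendezvous : ∀ {b a} (ρ : ComponentRun b) (ids : Fin k → Fin (size ρ)) →
    (∀ {l l′} → ids l ≡ ids l′ → l ≡ l′) → (src dst : Fin k → Fin nS) →
    (∀ l → conf ρ (ids l) ≡ (src l , comp b)) → (∀ l → Ru (comp b) (src l) (rdz a l) (dst l)) →
    ∀ h → Covering b (dst h)
  Covering-rendezvous {b} {a} ρ ids ids-inj src dst at-ids moves h = record
    { size = size ρ
    ; conf = conf′
    ; run = let f , init-f , path = run ρ in f , init-f , rstep path fire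
    ; confined = confined′
    } , ids h , conf′-ids h
    where
      L = comp b
      moved : ∀ i → Dec (∃ λ l → ids l ≡ i)
      moved i = any? (λ l → ids l ≟ᶠ i)
      after : ∀ i → Dec (∃ λ l → ids l ≡ i) → Fin nS × ℕ
      after i (yes (l , _)) = dst l , L
      after i (no _) = conf ρ i
      conf′ : Config (size ρ)
      conf′ i = after i (moved i)
      conf′-ids : ∀ l → conf′ (ids l) ≡ (dst l , L)
      conf′-ids l with moved (ids l)
      ... | yes (l′ , e) = cong (λ j → dst j , L) (ids-inj e)
      ... | no none = ⊥-elim (none (l , refl))
      conf′-rest : ∀ i → (∀ l → ids l ≢ i) → conf′ i ≡ conf ρ i
      conf′-rest i untouched with moved i
      ... | yes (l , e) = ⊥-elim (untouched l e)
      ... | no _ = refl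
      confined′ : ∀ i → InComponent L (conf′ i)
      confined′ i with moved i
      ... | yes (l , _) = component (tgt (moves l))
      ... | no _ = confined ρ i
      fire : RStep (conf ρ) conf′
      fire = record
        { act = a
        ; ids = ids
        ; ids-distinct = ids-inj
        ; moves = λ l → subst₂ (λ x y → Edge⊸ x (rdz a l) y) (sym (at-ids l)) (sym (conf′-ids l))
                          (rdzE (Next-≤ (comp-next b)) (moves l))
        ; rest = conf′-rest
        }

  Covering-rdz : ∀ {b a h s t} (w : Enabled (Su (comp b)) a) →
    (∀ l → Covering b (proj₁ (w l))) → R s (rdz a h) t → Covering b t
  Covering-rdz {b} {a} {h} {s} {t} w covers e =
    subst (Covering b) (sym t≡dst) (Covering-rendezvous ρ ids ids-inj src dst at-ids moves h)
    where
      G = proj₁ ∘ covers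
      ρ = ⨁ G
      src = λ l → proj₁ (w l)
      dst = λ l → proj₁ (proj₂ (w l))
      ids : Fin k → Fin (size ρ)
      ids l = ⨁-index G l (proj₁ (proj₂ (covers l)))
      ids-inj : ∀ {l l′} → ids l ≡ ids l′ → l ≡ l′
      ids-inj = ⨁-index-injective G
      at-ids : ∀ l → conf ρ (ids l) ≡ (src l , comp b)
      at-ids l = trans (⨁-conf G l _) (proj₂ (proj₂ (covers l)))
      moves : ∀ l → Ru (comp b) (src l) (rdz a l) (dst l)
      moves l = sat (proj₂ (proj₂ (proj₂ (w l)))) w
      -- a_h labels a single edge of P
      t≡dst : t ≡ dst h
      t≡dst = proj₂ (rdz-unique a h s t (src h) (dst h) e (proj₂ (proj₂ (proj₂ (w h)))))

  covering : ∀ b {s} → Su (comp b) s → Covering b s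
  covering-Iu : ∀ b {s} → Iu (comp b) s → Covering b s

  covering b (base iu) = covering-Iu b iu
  covering b (tgt (sat e w)) = Covering-rdz w (λ l → covering b (proj₁ (proj₂ (proj₂ (w l))))) e

  covering-Iu zero {s} iu with subst (λ L → Iu L s) comp-zero iu
  ... | init init-s = Covering-init init-s
  covering-Iu (suc b) iu =
    let _ , su , e = Equivalence.to (Next-Iu (comp-next b)) iu in Covering-bc (covering b su) e

  crowded-run : ∀ b N → Σ (ComponentRun b) λ ρ → ∀ s → Su (comp b) s → N ≤ preimageSize (conf ρ) (s , comp b)
  crowded-run b N = ⨁ block , λ s su → ≤-trans (block-crowded s (Su? (comp b) s) su) (preimageSize-⨁-≥ block s _)
    where
      block′ : ∀ s → Dec (Su (comp b) s) → ComponentRun b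
      block′ s (yes su) = ⨁ {j = N} λ _ → proj₁ (covering b su)
      block′ s (no _) = ∅
      block : Fin nS → ComponentRun b
      block s = block′ s (Su? (comp b) s)
      block-crowded : ∀ s d → Su (comp b) s → N ≤ preimageSize (conf (block′ s d)) (s , comp b)
      block-crowded s (yes su) _ = preimageSize-⨁-≥-arity _ _ (λ _ → Covering-occupied (covering b su))
      block-crowded s (no ¬su) su = ⊥-elim (¬su su)

lemma4 : ∀ {nS nA k : ℕ} → 1 ≤ k →
    (Init : Fin nS → Bool) (E : Fin nS → Label (Fin nA) k → Fin nS → Bool) →
    Unwinding.BcTotal Init E → Unwinding.RdzUnique Init E →
    (n m : ℕ) → Unwinding.IsUnwindingBounds Init E n m →
    ∀ (b N : ℕ) → ∃[ M ] Σ (Unwinding.Unwound.Config Init E n m M) λ f →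
      Unwinding.Unwound.Run Init E n m f b ×
      (∀ s → Unwinding.Su Init E (Unwinding.Unwound.comp Init E n m b) s →
        N ≤ Unwinding.Unwound.preimageSize Init E n m f
              (s , Unwinding.Unwound.comp Init E n m b))
lemma4 _ Init E bc-total rdz-unique n m (n≤m , loop , _) b N =
  let ρ , crowded = crowded-run b N in size ρ , conf ρ , run ρ , crowded
  where
    open Coverings Init E bc-total rdz-unique n m n≤m loop
    open ComponentRun
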